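{- Let $G$ be a connected $\gamma_{tR}$-ER-critical graph. If $f$ is a $\gamma_{tR}(G)$-function and $u,v\in V(G)$ satisfy $f(u)>0$ and $f(v)>0$, then $d(u,v)\leq 2$.
   Context: All graphs are finite and simple. A total Roman dominating function (TRD-function) on a graph $G$ with no isolated vertices is a function $f:V(G)\to\{0,1,2\}$ such that every vertex $v$ with $f(v)=0$ is adjacent to some $u$ with $f(u)=2$, and the subgraph induced by $\{w:f(w)>0\}$ has no isolated vertices; its weight is $\sum_v f(v)$, $\gamma_{tR}(G)$ is the minimum weight, and a TRD-function of weight $\gamma_{tR}(G)$ is a $\gamma_{tR}(G)$-function. For an edge $e$ incident with a vertex of degree $1$, define $\gamma_{tR}(G-e)=\infty$. A graph $G$ with no isolated vertices is $\gamma_{tR}$-ER-critical if $\gamma_{tR}(G-e)>\gamma_{tR}(G)$ for every edge $e\in E(G)$. $d(u,v)$ denotes the distance in $G$. -}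

module Defs where

open import Data.Nat using (ℕ; zero; suc; _+_; _≤_; _<_)
open import Data.Fin using (Fin; _≟_)
open import Data.List using (List; map)
open import Data.Nat.ListAction using (sum)
open import Data.Bool using (Bool; true; false; _∧_; _∨_; not; if_then_else_)
open import Data.Product using (Σ; ∃; ∃-syntax; _×_; _,_)
open import Data.Sum using (_⊎_)
open import Relation.Binary.PropositionalEquality using (_≡_)
open import Relation.Nullary.Decidable using (⌊_⌋)

open import Data.List using () renaming (allFin to allFinL)

Graph : ℕ → Set
Graph n = Fin n → Fin n → Bool

IsSimple : {n : ℕ} → Graph n → Set
IsSimple {n} G = (∀ u v → G u v ≡ G v u) × (∀ v → G v v ≡ false)

Adj : {n : ℕ} → Graph n → Fin n → Fin n → Set
Adj G u v = G u v ≡ true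

NoIsolated : {n : ℕ} → Graph n → Set
NoIsolated {n} G = ∀ v → ∃[ u ] Adj G v u

degree : {n : ℕ} → Graph n → Fin n → ℕ
degree {n} G v = sum (map (λ u → if G v u then 1 else 0) (allFinL n))

data Walk {n : ℕ} (G : Graph n) : Fin n → Fin n → ℕ → Set where
  here : ∀ {v} → Walk G v v zero
  step : ∀ {u w v k} → Adj G u w → Walk G w v k → Walk G u v (suc k)

Connected : {n : ℕ} → Graph n → Set
Connected {n} G = ∀ u v → ∃[ k ] Walk G u v k

-- d(u,v) ≤ k : there is a walk (equivalently, a path) of length at most k
DistLe : {n : ℕ} → Graph n → Fin n → Fin n → ℕ → Set
DistLe G u v k = ∃[ j ] (j ≤ k × Walk G u v j)

deleteEdge : {n : ℕ} → Graph n → Fin n → Fin n → Graph n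
deleteEdge G u v x y =
  G x y ∧ not ((⌊ x ≟ u ⌋ ∧ ⌊ y ≟ v ⌋) ∨ (⌊ x ≟ v ⌋ ∧ ⌊ y ≟ u ⌋))

-- total Roman dominating function (values in {0,1,2} as naturals ≤ 2)
IsTRDF : {n : ℕ} → Graph n → (Fin n → ℕ) → Set
IsTRDF {n} G f =
  (∀ v → f v ≤ 2)
  × (∀ v → f v ≡ 0 → ∃[ u ] (Adj G v u × f u ≡ 2))
  × (∀ v → 0 < f v → ∃[ u ] (Adj G v u × 0 < f u))

weight : {n : ℕ} → (Fin n → ℕ) → ℕ
weight {n} f = sum (map f (allFinL n))

IsGammaTR : {n : ℕ} → Graph n → ℕ → Set
IsGammaTR {n} G k =
  (∃[ f ] (IsTRDF G f × weight f ≡ k))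
  × (∀ f → IsTRDF G f → k ≤ weight f)

IsGammaTRFunction : {n : ℕ} → Graph n → (Fin n → ℕ) → Set
IsGammaTRFunction {n} G f = IsTRDF G f × (∀ g → IsTRDF G g → weight f ≤ weight g)

-- γ_tR(G - e) > γ_tR(G), where γ_tR(G - e) = ∞ if e is incident with a
-- vertex of degree 1 (then the inequality holds automatically); otherwise
-- every TRD-function of G - e has weight exceeding γ_tR(G).
RemovalIncreases : {n : ℕ} → Graph n → Fin n → Fin n → Set
RemovalIncreases {n} G u v =
  (degree G u ≡ 1 ⊎ degree G v ≡ 1)
  ⊎ (∀ k → IsGammaTR G k → ∀ g → IsTRDF (deleteEdge G u v) g → k < weight g)

IsERCritical : {n : ℕ} → Graph n → Set
IsERCritical {n} G = NoIsolated G × (∀ u v → Adj G u v → RemovalIncreases G u v)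

-- In an edge-removal-critical graph no γ_tR-function f stays a TRD-function of
-- G − xy for any edge xy.  Hence, at every edge, one endpoint can only be served
-- (by a 2-neighbour if it has value 0, by a positive neighbour otherwise) through
-- the other endpoint.  Two consequences: a vertex of value 0 is a leaf, and of two
-- adjacent positive vertices one has no further positive neighbour.  So a walk
-- between positive vertices of length at least 3 can always be shortened by 2,
-- which leaves a walk of length at most 2.
module Submission where

open import Defs
open import Data.Nat using (ℕ; zero; suc; _+_; _≤_; _<_; z≤n; s≤s)
open import Data.Nat.Properties using (≤-trans; m≤m+n; m≤n+m; +-comm; +-monoʳ-≤; <-irrefl)
open import Data.Fin using (Fin; _≟_) renaming (zero to fzero; suc to fsuc)
open import Data.List using (tabulate)
open import Data.List.Properties using (map-tabulate)
open import Data.Nat.ListAction using (sum)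
open import Data.Bool using (false; _∧_; if_then_else_)
open import Data.Product using (∃-syntax; _×_; _,_; proj₁; proj₂)
open import Data.Sum using (_⊎_; inj₁; inj₂)
open import Data.Empty using (⊥-elim)
open import Relation.Nullary using (¬_; Dec; yes; no)
open import Relation.Nullary.Decidable using (⌊_⌋)
open import Relation.Binary.PropositionalEquality
  using (_≡_; _≢_; refl; sym; trans; cong; subst)
open import Function using (_∘_; id)

zero-or-positive : ∀ m → m ≡ 0 ⊎ 0 < m
zero-or-positive zero    = inj₁ refl
zero-or-positive (suc m) = inj₂ (s≤s z≤n)

≤-sum-tabulate : ∀ {n} (h : Fin n → ℕ) a → h a ≤ sum (tabulate h)
≤-sum-tabulate h fzero    = m≤m+n _ _
≤-sum-tabulate h (fsuc a) = ≤-trans (≤-sum-tabulate (h ∘ fsuc) a) (m≤n+m _ (h fzero))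

+-≤-sum-tabulate : ∀ {n} (h : Fin n → ℕ) {a b} → a ≢ b → h a + h b ≤ sum (tabulate h)
+-≤-sum-tabulate h {fzero}  {fzero}  a≢b = ⊥-elim (a≢b refl)
+-≤-sum-tabulate h {fzero}  {fsuc b} _   = +-monoʳ-≤ (h fzero) (≤-sum-tabulate (h ∘ fsuc) b)
+-≤-sum-tabulate h {fsuc a} {fzero}  _
  rewrite +-comm (h (fsuc a)) (h fzero) = +-monoʳ-≤ (h fzero) (≤-sum-tabulate (h ∘ fsuc) a)
+-≤-sum-tabulate h {fsuc a} {fsuc b} a≢b =
  ≤-trans (+-≤-sum-tabulate (h ∘ fsuc) (a≢b ∘ cong fsuc)) (m≤n+m _ (h fzero))

degree-one⇒unique-neighbour : ∀ {n} (G : Graph n) {x a b} →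
  degree G x ≡ 1 → Adj G x a → Adj G x b → a ≡ b
degree-one⇒unique-neighbour {n} G {x} {a} {b} deg≡1 xa xb with a ≟ b
... | yes a≡b = a≡b
... | no  a≢b = ⊥-elim (two≰one (subst (indicator a + indicator b ≤_) degree≡ (+-≤-sum-tabulate indicator a≢b)))
  where
  indicator : Fin n → ℕ
  indicator u = if G x u then 1 else 0
  degree≡ : sum (tabulate indicator) ≡ 1
  degree≡ = trans (cong sum (sym (map-tabulate id indicator))) deg≡1
  two≰one : ¬ indicator a + indicator b ≤ 1
  two≰one rewrite xa | xb = λ { (s≤s ()) }

∧-≟-false : ∀ {n} {a b c d : Fin n} → ¬ (a ≡ b × c ≡ d) → (⌊ a ≟ b ⌋ ∧ ⌊ c ≟ d ⌋) ≡ false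
∧-≟-false {a = a} {b} {c} {d} ¬eq with a ≟ b | c ≟ d
... | yes a≡b | yes c≡d = ⊥-elim (¬eq (a≡b , c≡d))
... | yes _   | no  _   = refl
... | no  _   | _       = refl

deleteEdge-adj : ∀ {n} (G : Graph n) {x y w u} → Adj G w u →
  ¬ (w ≡ x × u ≡ y) → ¬ (w ≡ y × u ≡ x) → Adj (deleteEdge G x y) w u
deleteEdge-adj G wu ¬xy ¬yx rewrite wu | ∧-≟-false ¬xy | ∧-≟-false ¬yx = refl

record Serves {n} (f : Fin n → ℕ) (x u : Fin n) : Set where
  constructor serves-by
  field
    when-zero     : f x ≡ 0 → f u ≡ 2
    when-positive : 0 < f x → 0 < f u

ServedWithout : ∀ {n} → Graph n → (Fin n → ℕ) → Fin n → Fin n → Set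
ServedWithout G f x y = ∃[ u ] (Adj G x u × Serves f x u × u ≢ y)

module _ {n} {f : Fin n → ℕ} where

  positive-serves-positive : ∀ {x u} → 0 < f x → 0 < f u → Serves f x u
  positive-serves-positive 0<fx 0<fu = serves-by (λ fx≡0 → ⊥-elim (<-irrefl (sym fx≡0) 0<fx)) λ _ → 0<fu

  server-positive : ∀ {x u} → Serves f x u → 0 < f u
  server-positive {x} (serves-by ifZero ifPositive) with zero-or-positive (f x)
  ... | inj₁ fx≡0 rewrite ifZero fx≡0 = s≤s z≤n
  ... | inj₂ 0<fx = ifPositive 0<fx

module _ {n} {G : Graph n} {f : Fin n → ℕ} where

  served : IsTRDF G f → ∀ x → ∃[ u ] (Adj G x u × Serves f x u)
  served (_ , zeros , positives) x with zero-or-positive (f x)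
  ... | inj₁ fx≡0 = let u , xu , fu≡2 = zeros x fx≡0 in
    u , xu , serves-by (λ _ → fu≡2) λ 0<fx → ⊥-elim (<-irrefl (sym fx≡0) 0<fx)
  ... | inj₂ 0<fx = let u , xu , 0<fu = positives x 0<fx in
    u , xu , positive-serves-positive 0<fx 0<fu

  served-without-zero : IsTRDF G f → ∀ {x y} → f y ≡ 0 → ServedWithout G f x y
  served-without-zero trdf {x} fy≡0 =
    let u , xu , serving = served trdf x in
    u , xu , serving , λ { refl → <-irrefl (sym fy≡0) (server-positive serving) }

  trdf-from-served : (∀ v → f v ≤ 2) → ∀ (H : Graph n) →
    (∀ x → ∃[ u ] (Adj H x u × Serves f x u)) → IsTRDF H f
  trdf-from-served bounded H servedH = bounded , zeros , positives
    where
    zeros : ∀ v → f v ≡ 0 → ∃[ u ] (Adj H v u × f u ≡ 2)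
    zeros v fv≡0 = let u , vu , serving = servedH v in u , vu , Serves.when-zero serving fv≡0
    positives : ∀ v → 0 < f v → ∃[ u ] (Adj H v u × 0 < f u)
    positives v 0<fv = let u , vu , serving = servedH v in u , vu , Serves.when-positive serving 0<fv

  deleteEdge-preserves-TRDF : IsTRDF G f → ∀ {x y} → x ≢ y →
    ServedWithout G f x y → ServedWithout G f y x → IsTRDF (deleteEdge G x y) f
  deleteEdge-preserves-TRDF trdf {x} {y} x≢y (ux , xux , servesx , ux≢y) (uy , yuy , servesy , uy≢x) =
    trdf-from-served (proj₁ trdf) (deleteEdge G x y) servedAfter
    where
    servedAfter : ∀ w → ∃[ u ] (Adj (deleteEdge G x y) w u × Serves f w u)
    servedAfter w = by-cases (w ≟ x) (w ≟ y)
      where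
      by-cases : Dec (w ≡ x) → Dec (w ≡ y) → ∃[ u ] (Adj (deleteEdge G x y) w u × Serves f w u)
      by-cases (yes refl) _ = ux , deleteEdge-adj G xux (ux≢y ∘ proj₂) (x≢y ∘ proj₁) , servesx
      by-cases (no w≢x) (yes refl) = uy , deleteEdge-adj G yuy (w≢x ∘ proj₁) (uy≢x ∘ proj₂) , servesy
      by-cases (no w≢x) (no w≢y) =
        let u , wu , serving = served trdf w in
        u , deleteEdge-adj G wu (w≢x ∘ proj₁) (w≢y ∘ proj₁) , serving

module _ {n} {G : Graph n} (simple : IsSimple G) (critical : IsERCritical G)
         {f : Fin n → ℕ} (γf : IsGammaTRFunction G f) where

  private
    trdf : IsTRDF G f
    trdf = proj₁ γf

    adj-sym : ∀ {x y} → Adj G x y → Adj G y x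
    adj-sym {x} {y} xy = trans (proj₁ simple y x) xy

    adj-irrefl : ∀ {x y} → Adj G x y → x ≢ y
    adj-irrefl {x} xx refl with trans (sym xx) (proj₂ simple x)
    ... | ()

    not-a-leaf : ∀ {x y} → Adj G x y → ServedWithout G f x y → ¬ degree G x ≡ 1
    not-a-leaf xy (u , xu , _ , u≢y) deg≡1 = u≢y (degree-one⇒unique-neighbour G deg≡1 xu xy)

  critical-edge : ∀ {x y} → Adj G x y → ¬ (ServedWithout G f x y × ServedWithout G f y x)
  critical-edge {x} {y} xy (withoutY , withoutX) with proj₂ critical x y xy
  ... | inj₁ (inj₁ deg≡1) = not-a-leaf xy withoutY deg≡1
  ... | inj₁ (inj₂ deg≡1) = not-a-leaf (adj-sym xy) withoutX deg≡1
  ... | inj₂ increases = <-irrefl refl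
    (increases (weight f) ((f , trdf , refl) , proj₂ γf) f
      (deleteEdge-preserves-TRDF trdf (adj-irrefl xy) withoutY withoutX))

  zero-vertex-backtracks : ∀ {x w y} → f w ≡ 0 → Adj G x w → Adj G w y → x ≡ y
  zero-vertex-backtracks {w = w} fw≡0 xw wy with served trdf w
  ... | s , ws , serving = trans (only-server (adj-sym xw)) (sym (only-server wy))
    where
    only-server : ∀ {z} → Adj G w z → z ≡ s
    only-server {z} wz with z ≟ s
    ... | yes z≡s = z≡s
    ... | no z≢s = ⊥-elim (critical-edge wz
      ((s , ws , serving , z≢s ∘ sym) , served-without-zero trdf fw≡0))

  positive-edge-has-pendant-end : ∀ {u x y z} → Adj G x y → 0 < f x → 0 < f y →
    Adj G x u → 0 < f u → Adj G y z → 0 < f z → u ≡ y ⊎ z ≡ x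
  positive-edge-has-pendant-end {u} {x} {y} {z} xy 0<fx 0<fy xu 0<fu yz 0<fz with u ≟ y | z ≟ x
  ... | yes u≡y | _ = inj₁ u≡y
  ... | no _ | yes z≡x = inj₂ z≡x
  ... | no u≢y | no z≢x = ⊥-elim (critical-edge xy
    ( (u , xu , positive-serves-positive 0<fx 0<fu , u≢y)
    , (z , yz , positive-serves-positive 0<fy 0<fz , z≢x) ))

  shorten-by-two : ∀ {u v k} → 0 < f u → 0 < f v → Walk G u v (3 + k) → Walk G u v (1 + k)
  shorten-by-two {v = v} 0<fu 0<fv (step {w = w₁} uw₁ (step {w = w₂} w₁w₂ (step {w = w₃} w₂w₃ rest)))
    with zero-or-positive (f w₁) | zero-or-positive (f w₂) | zero-or-positive (f w₃)
  ... | inj₁ fw₁≡0 | _ | _ =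
    subst (λ s → Walk G s v _) (sym (zero-vertex-backtracks fw₁≡0 uw₁ w₁w₂)) (step w₂w₃ rest)
  ... | inj₂ _ | inj₁ fw₂≡0 | _ =
    step uw₁ (subst (λ s → Walk G s v _) (sym (zero-vertex-backtracks fw₂≡0 w₁w₂ w₂w₃)) rest)
  ... | inj₂ _ | inj₂ _ | inj₁ fw₃≡0 = skip-zero rest fw₃≡0
    where
    skip-zero : ∀ {k} → Walk G w₃ v k → f w₃ ≡ 0 → Walk G _ v (1 + k)
    skip-zero here fv≡0 = ⊥-elim (<-irrefl (sym fv≡0) 0<fv)
    skip-zero (step w₃w₄ rest′) _ =
      step uw₁ (step w₁w₂ (subst (λ s → Walk G s v _) (sym (zero-vertex-backtracks fw₃≡0 w₂w₃ w₃w₄)) rest′))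
  ... | inj₂ 0<fw₁ | inj₂ 0<fw₂ | inj₂ 0<fw₃
    with positive-edge-has-pendant-end w₁w₂ 0<fw₁ 0<fw₂ (adj-sym uw₁) 0<fu w₂w₃ 0<fw₃
  ... | inj₁ refl = step w₂w₃ rest
  ... | inj₂ refl = step uw₁ rest

  walk⇒dist≤2 : ∀ {u v} k → 0 < f u → 0 < f v → Walk G u v k → DistLe G u v 2
  walk⇒dist≤2 0 _ _ walk = 0 , z≤n , walk
  walk⇒dist≤2 1 _ _ walk = 1 , s≤s z≤n , walk
  walk⇒dist≤2 2 _ _ walk = 2 , s≤s (s≤s z≤n) , walk
  walk⇒dist≤2 (suc (suc (suc k))) 0<fu 0<fv walk =
    walk⇒dist≤2 (suc k) 0<fu 0<fv (shorten-by-two 0<fu 0<fv walk)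

proposition7p9 : {n : ℕ} (G : Graph n) → IsSimple G → Connected G
    → IsERCritical G
    → (f : Fin n → ℕ) → IsGammaTRFunction G f
    → (u v : Fin n) → 0 < f u → 0 < f v
    → DistLe G u v 2
proposition7p9 G simple connected critical f γf u v 0<fu 0<fv =
  let k , walk = connected u v in walk⇒dist≤2 simple critical γf k 0<fu 0<fv walk
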